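{- For every integer $n \geq 1$, $|\mathbf{I}_n(210)|=|\mathbf{I}_n(201)|$.
   Context: An inversion sequence of length $n$ is an integer sequence $e=(e_1,\ldots,e_n)$ with $0 \le e_i < i$ for all $i$; $\mathbf{I}_n$ is the set of these. $\mathbf{I}_n(210)$ is the set of $e\in\mathbf{I}_n$ with no indices $i<j<k$ such that $e_i>e_j>e_k$; $\mathbf{I}_n(201)$ is the set of $e\in\mathbf{I}_n$ with no indices $i<j<k$ such that $e_j<e_k<e_i$. -}

module Defs where

open import Data.Nat using (ℕ; zero; suc; _<_; _<?_)
open import Data.Fin using (Fin; toℕ)
open import Data.Product using (_×_)
open import Relation.Nullary using (¬_)
open import Data.Product using (Σ; proj₁)
open import Relation.Binary.PropositionalEquality using (_≡_)

-- An inversion sequence of length n, 0-indexed: position i ∈ {0,…,n-1}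
-- (paper's index i+1) carries a value e i with 0 ≤ e i < i+1.
InvSeq : ℕ → Set
InvSeq n = (i : Fin n) → Fin (suc (toℕ i))

val : ∀ {n} → InvSeq n → Fin n → ℕ
val e i = toℕ (e i)

_<ᶠ_ : ∀ {n} → Fin n → Fin n → Set
i <ᶠ j = toℕ i < toℕ j

Avoids210 : ∀ {n} → InvSeq n → Set
Avoids210 {n} e = (i j k : Fin n) → i <ᶠ j → j <ᶠ k →
  ¬ (val e j < val e i × val e k < val e j)

Avoids201 : ∀ {n} → InvSeq n → Set
Avoids201 {n} e = (i j k : Fin n) → i <ᶠ j → j <ᶠ k →
  ¬ (val e j < val e k × val e k < val e i)

I210 : ℕ → Set
I210 n = Σ (InvSeq n) Avoids210

I201 : ℕ → Set
I201 n = Σ (InvSeq n) Avoids201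

-- Pointwise equality of inversion sequences (the right equality on
-- function-represented sequences without function extensionality).
_≈ˢ_ : ∀ {n} → InvSeq n → InvSeq n → Set
e ≈ˢ e' = ∀ i → e i ≡ e' i

record SameSize (n : ℕ) : Set where
  field
    to      : I210 n → I201 n
    from    : I201 n → I210 n
    from∘to : ∀ x → proj₁ (from (to x)) ≈ˢ proj₁ x
    to∘from : ∀ y → proj₁ (to (from y)) ≈ˢ proj₁ y

module Submission where

-- Grow an inversion sequence one entry at a time and let M be the largest
-- entry so far.  For both patterns the values that may be appended to an
-- avoiding prefix are governed by a small state:
--   * after a 210-avoider l, exactly the values x ≥ bound210 l may follow,
--     where bound210 l is the largest lower end b of a descent a ⋯ b, b < a;
--   * after a 201-avoider r, exactly the values y ≥ M may follow, together
--     with an increasing list gaps201 r of values below M.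
-- Call l and r corresponding when they have the same maximum M and
-- |gaps201 r| + bound210 l = M, i.e. equally many admissible values below M.
-- Then the next entries can be exchanged (values ≥ M are kept; x < M goes to
-- the (M-1-x)-th smallest gap and back), and the extended prefixes correspond
-- again.  Iterating gives mutually inverse maps Φ and Ψ on lists.

open import Defs
open import Data.Nat
open import Data.Nat.Properties
open import Data.Fin using (Fin; toℕ; fromℕ<)
open import Data.Fin.Properties using (toℕ-fromℕ<; fromℕ<-toℕ; toℕ<n; toℕ-injective)
open import Data.List using (List; []; _∷_; length; _++_; foldr; filter; applyUpTo; applyDownFrom)
open import Data.List.Properties
  using ( length-++; length-applyUpTo; length-applyDownFrom
        ; filter-accept; filter-reject; filter-none; filter-notAll )
open import Data.List.Relation.Unary.All as All using (All; []; _∷_)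
import Data.List.Relation.Unary.All.Properties as All
import Data.List.Relation.Unary.Any as Any
open import Data.List.Relation.Unary.Any using (here; there)
import Data.List.Relation.Unary.Any.Properties as Any
open import Data.List.Relation.Unary.AllPairs using (AllPairs; []; _∷_)
import Data.List.Relation.Unary.AllPairs.Properties as AllPairs
open import Data.List.Membership.Propositional using (_∈_; _∉_)
open import Data.List.Membership.Propositional.Properties
  using (∈-filter⁺; ∈-filter⁻; ∈-++⁺ˡ; ∈-++⁺ʳ; ∈-++⁻; ∈-applyUpTo⁺; ∈-applyUpTo⁻)
open import Data.List.Membership.DecPropositional _≟_ using (_∈?_)
open import Data.Product using (Σ; ∃-syntax; _×_; _,_; proj₁; proj₂)
open import Data.Sum using (_⊎_; inj₁; inj₂)
open import Data.Unit using (⊤; tt)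
open import Data.Empty using (⊥; ⊥-elim)
open import Function using (_∘_)
open import Relation.Nullary using (¬_; yes; no)
open import Relation.Binary.PropositionalEquality

-- Sequences as lists, the most recent entry first: c ∷ xs is the sequence xs
-- followed by the entry c.

peak : List ℕ → ℕ
peak = foldr _⊔_ 0

∈⇒≤peak : ∀ {a xs} → a ∈ xs → a ≤ peak xs
∈⇒≤peak {xs = z ∷ xs} (here refl) = m≤m⊔n z (peak xs)
∈⇒≤peak {xs = z ∷ xs} (there a∈xs) = ≤-trans (∈⇒≤peak a∈xs) (m≤n⊔m z (peak xs))

<peak⇒∃ : ∀ {x} xs → x < peak xs → ∃[ a ] a ∈ xs × x < a
<peak⇒∃ {x} (z ∷ xs) x<peak with ⊔-sel z (peak xs)
... | inj₁ eq = z , here refl , subst (x <_) eq x<peak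
... | inj₂ eq = let a , a∈xs , x<a = <peak⇒∃ xs (subst (x <_) eq x<peak)
                in a , there a∈xs , x<a

peak-mono : ∀ z xs → peak xs ≤ peak (z ∷ xs)
peak-mono z xs = m≤n⊔m z (peak xs)

peak-below : ∀ {z} xs → z < peak xs → peak (z ∷ xs) ≡ peak xs
peak-below xs z<peak = m≤n⇒m⊔n≡n (<⇒≤ z<peak)

peak-above : ∀ {z} xs → ¬ z < peak xs → peak (z ∷ xs) ≡ z
peak-above xs z≮peak = m≥n⇒m⊔n≡m (≮⇒≥ z≮peak)

data Before : List ℕ → ℕ → ℕ → Set where
  earlier : ∀ {x xs a b} → Before xs a b → Before (x ∷ xs) a b
  newest  : ∀ {xs a b} → a ∈ xs → Before (b ∷ xs) a b

Pattern : Set₁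
Pattern = ℕ → ℕ → ℕ → Set

P210 : Pattern
P210 a b c = b < a × c < b

P201 : Pattern
P201 a b c = b < c × c < a

Completes : Pattern → List ℕ → ℕ → Set
Completes P xs c = ∃[ a ] ∃[ b ] Before xs a b × P a b c

completes-earlier : ∀ P {xs c} z → Completes P xs c → Completes P (z ∷ xs) c
completes-earlier P z (a , b , a⋯b , pat) = a , b , earlier a⋯b , pat

Avoiding : Pattern → List ℕ → Set
Avoiding P []       = ⊤
Avoiding P (c ∷ xs) = Avoiding P xs × ¬ Completes P xs c

-- the i-th entry (counted from 0) is at most i
IsInvSeq : List ℕ → Set
IsInvSeq []       = ⊤
IsInvSeq (x ∷ xs) = x ≤ length xs × IsInvSeq xs

peak≤length : ∀ xs → IsInvSeq xs → peak xs ≤ length xs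
peak≤length []       _          = z≤n
peak≤length (x ∷ xs) (x≤ , inv) =
  ⊔-lub (m≤n⇒m≤1+n x≤) (m≤n⇒m≤1+n (peak≤length xs inv))

-- The 210 state: the largest value that ends a descent.  An entry z ends a
-- descent exactly when it lies below the peak of the entries before it.
bound210 : List ℕ → ℕ
bound210 []       = 0
bound210 (z ∷ xs) with z <? peak xs
... | yes _ = bound210 xs ⊔ z
... | no  _ = bound210 xs

bound210-below : ∀ {z} xs → z < peak xs → bound210 (z ∷ xs) ≡ bound210 xs ⊔ z
bound210-below {z} xs z<peak with z <? peak xs
... | yes _     = refl
... | no z≮peak = ⊥-elim (z≮peak z<peak)

bound210-above : ∀ {z} xs → ¬ z < peak xs → bound210 (z ∷ xs) ≡ bound210 xs
bound210-above {z} xs z≮peak with z <? peak xs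
... | yes z<peak = ⊥-elim (z≮peak z<peak)
... | no  _      = refl

completes210⇒<bound : ∀ xs {x} → Completes P210 xs x → x < bound210 xs
completes210⇒<bound (z ∷ xs) (a , b , earlier a⋯b , pat) with z <? peak xs
... | yes _ = m<n⇒m<n⊔o z (completes210⇒<bound xs (a , b , a⋯b , pat))
... | no  _ = completes210⇒<bound xs (a , b , a⋯b , pat)
completes210⇒<bound (z ∷ xs) (a , .z , newest a∈xs , z<a , x<z) with z <? peak xs
... | yes _     = m<n⇒m<o⊔n (bound210 xs) x<z
... | no z≮peak = ⊥-elim (z≮peak (<-≤-trans z<a (∈⇒≤peak a∈xs)))

<bound⇒completes210 : ∀ xs {x} → x < bound210 xs → Completes P210 xs x
<bound⇒completes210 (z ∷ xs) {x} x<bound with z <? peak xs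
... | no  _ = completes-earlier P210 z (<bound⇒completes210 xs x<bound)
... | yes z<peak with ⊔-sel (bound210 xs) z
...   | inj₁ eq = completes-earlier P210 z (<bound⇒completes210 xs (subst (x <_) eq x<bound))
...   | inj₂ eq = let a , a∈xs , z<a = <peak⇒∃ xs z<peak
                  in a , z , newest a∈xs , z<a , subst (x <_) eq x<bound

admissible210⇒ : ∀ xs {x} → ¬ Completes P210 xs x → bound210 xs ≤ x
admissible210⇒ xs ¬210 = ≮⇒≥ (¬210 ∘ <bound⇒completes210 xs)

⇒admissible210 : ∀ xs {x} → bound210 xs ≤ x → ¬ Completes P210 xs x
⇒admissible210 xs bound≤x c = <⇒≱ (completes210⇒<bound xs c) bound≤x

Sorted : List ℕ → Set
Sorted = AllPairs _<_

-- the entry at position j (0 beyond the end)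
nth : List ℕ → ℕ → ℕ
nth []      _       = 0
nth (y ∷ l) zero    = y
nth (y ∷ l) (suc j) = nth l j

nth-∈ : ∀ l {j} → j < length l → nth l j ∈ l
nth-∈ (y ∷ l) {zero}  _         = here refl
nth-∈ (y ∷ l) {suc j} (s≤s j<) = there (nth-∈ l j<)

-- if all entries are below a positive M, so is every nth (including the default 0)
nth-< : ∀ {M} l j → 0 < M → All (_< M) l → nth l j < M
nth-< []      j       0<M _            = 0<M
nth-< (y ∷ l) zero    _   (y<M ∷ _)    = y<M
nth-< (y ∷ l) (suc j) 0<M (_ ∷ l<M)    = nth-< l j 0<M l<M

rank : ℕ → List ℕ → ℕ
rank x l = length (filter (_<? x) l)

rank<length : ∀ {x} l → x ∈ l → rank x l < length l
rank<length {x} l x∈l = filter-notAll (_<? x) l (Any.map (λ { refl → <-irrefl refl }) x∈l)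

rank-least : ∀ {y l} → All (y <_) l → rank y (y ∷ l) ≡ 0
rank-least {y} y<l =
  cong length (trans (filter-reject (_<? y) (<-irrefl refl))
                     (filter-none (_<? y) (All.map (λ y<w w<y → <-asym y<w w<y) y<l)))

atMost-least : ∀ {y l} → All (y <_) l → filter (_≤? y) (y ∷ l) ≡ y ∷ []
atMost-least {y} y<l =
  trans (filter-accept (_≤? y) ≤-refl)
        (cong (y ∷_) (filter-none (_≤? y) (All.map <⇒≱ y<l)))

rank-nth : ∀ {l j} → Sorted l → j < length l → rank (nth l j) l ≡ j
rank-nth {y ∷ l} {zero}  (y<l ∷ _)      _        = rank-least y<l
rank-nth {y ∷ l} {suc j} (y<l ∷ sorted) (s≤s j<) =
  trans (cong length (filter-accept (_<? nth l j) (All.lookup y<l (nth-∈ l j<))))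
        (cong suc (rank-nth sorted j<))

nth-rank : ∀ {l x} → Sorted l → x ∈ l → nth l (rank x l) ≡ x
nth-rank {x ∷ l} (x<l ∷ _)      (here refl) = cong (nth (x ∷ l)) (rank-least x<l)
nth-rank {y ∷ l} {x} (y<l ∷ sorted) (there x∈l) =
  trans (cong (nth (y ∷ l) ∘ length) (filter-accept (_<? x) (All.lookup y<l x∈l)))
        (nth-rank sorted x∈l)

length-atMost : ∀ {l x} → Sorted l → x ∈ l → length (filter (_≤? x) l) ≡ suc (rank x l)
length-atMost {x ∷ l} (x<l ∷ _) (here refl) =
  trans (cong length (atMost-least x<l)) (sym (cong suc (rank-least x<l)))
length-atMost {y ∷ l} {x} (y<l ∷ sorted) (there x∈l) =
  trans (cong length (filter-accept (_≤? x) (<⇒≤ y<x)))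
        (cong suc (trans (length-atMost sorted x∈l)
                         (sym (cong length (filter-accept (_<? x) y<x)))))
  where y<x = All.lookup y<l x∈l

interval : ℕ → ℕ → List ℕ
interval M z = applyUpTo (M +_) (z ∸ M)

∈-interval⁻ : ∀ {M z v} → M ≤ z → v ∈ interval M z → M ≤ v × v < z
∈-interval⁻ {M} M≤z v∈ with i , i<k , refl ← ∈-applyUpTo⁻ (M +_) v∈ =
  m≤m+n M i , subst (M + i <_) (m+[n∸m]≡n M≤z) (+-monoʳ-< M i<k)

∈-interval⁺ : ∀ {M z v} → M ≤ v → v < z → v ∈ interval M z
∈-interval⁺ {M} {z} {v} M≤v v<z =
  subst (_∈ interval M z) (m+[n∸m]≡n M≤v)
        (∈-applyUpTo⁺ (M +_) (+-cancelˡ-< M (v ∸ M) (z ∸ M) M+[v∸M]<M+[z∸M]))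
  where
  M+[v∸M]<M+[z∸M] : M + (v ∸ M) < M + (z ∸ M)
  M+[v∸M]<M+[z∸M] = subst₂ _<_ (sym (m+[n∸m]≡n M≤v))
                               (sym (m+[n∸m]≡n (≤-trans M≤v (<⇒≤ v<z)))) v<z

interval-sorted : ∀ M z → Sorted (interval M z)
interval-sorted M z = AllPairs.applyUpTo⁺₁ (M +_) (z ∸ M) (λ i<j _ → +-monoʳ-< M i<j)

-- The 201 state: the admissible values below the peak, in increasing order.
gaps201 : List ℕ → List ℕ
gaps201 []       = []
gaps201 (z ∷ xs) with z <? peak xs
... | yes _ = filter (_≤? z) (gaps201 xs)
... | no  _ = gaps201 xs ++ interval (peak xs) z

gaps201-below : ∀ {z} xs → z < peak xs → gaps201 (z ∷ xs) ≡ filter (_≤? z) (gaps201 xs)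
gaps201-below {z} xs z<peak with z <? peak xs
... | yes _     = refl
... | no z≮peak = ⊥-elim (z≮peak z<peak)

gaps201-above : ∀ {z} xs → ¬ z < peak xs → gaps201 (z ∷ xs) ≡ gaps201 xs ++ interval (peak xs) z
gaps201-above {z} xs z≮peak with z <? peak xs
... | yes z<peak = ⊥-elim (z≮peak z<peak)
... | no  _      = refl

gaps201-<peak : ∀ xs → All (_< peak xs) (gaps201 xs)
gaps201-<peak []       = []
gaps201-<peak (z ∷ xs) with z <? peak xs
... | yes _     = All.map (λ w< → <-≤-trans w< (peak-mono z xs))
                          (All.filter⁺ (_≤? z) (gaps201-<peak xs))
... | no z≮peak = All.++⁺ (All.map (λ w< → <-≤-trans w< (peak-mono z xs)) (gaps201-<peak xs))
                          (All.tabulate λ v∈ → <-≤-trans (proj₂ (∈-interval⁻ (≮⇒≥ z≮peak) v∈))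
                                                         (m≤m⊔n z (peak xs)))

gaps201-sorted : ∀ xs → Sorted (gaps201 xs)
gaps201-sorted []       = []
gaps201-sorted (z ∷ xs) with z <? peak xs
... | yes _     = AllPairs.filter⁺ (_≤? z) (gaps201-sorted xs)
... | no z≮peak = AllPairs.++⁺ (gaps201-sorted xs) (interval-sorted (peak xs) z)
                    (All.map (λ w<peak → All.tabulate λ v∈ →
                                <-≤-trans w<peak (proj₁ (∈-interval⁻ (≮⇒≥ z≮peak) v∈)))
                             (gaps201-<peak xs))

completes201⇒ : ∀ xs {y} → Completes P201 xs y → y < peak xs × y ∉ gaps201 xs
completes201⇒ (z ∷ xs) {y} (a , b , earlier a⋯b , pat)
  with y<peak , y∉gaps ← completes201⇒ xs (a , b , a⋯b , pat) | z <? peak xs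
... | yes _     = <-≤-trans y<peak (peak-mono z xs) , y∉gaps ∘ proj₁ ∘ ∈-filter⁻ (_≤? z)
... | no z≮peak = <-≤-trans y<peak (peak-mono z xs) , λ y∈ → case-++ (∈-++⁻ (gaps201 xs) y∈)
  where
  case-++ : y ∈ gaps201 xs ⊎ y ∈ interval (peak xs) z → ⊥
  case-++ (inj₁ y∈gaps) = y∉gaps y∈gaps
  case-++ (inj₂ y∈int)  = <⇒≱ y<peak (proj₁ (∈-interval⁻ (≮⇒≥ z≮peak) y∈int))
completes201⇒ (z ∷ xs) {y} (a , .z , newest a∈xs , z<y , y<a) with z <? peak xs
... | yes _     = <-≤-trans y<a (≤-trans (∈⇒≤peak a∈xs) (peak-mono z xs))
                , λ y∈ → <⇒≱ z<y (proj₂ (∈-filter⁻ (_≤? z) {xs = gaps201 xs} y∈))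
... | no z≮peak = ⊥-elim (z≮peak (<-trans z<y (<-≤-trans y<a (∈⇒≤peak a∈xs))))

⇒completes201 : ∀ xs {y} → y < peak xs → y ∉ gaps201 xs → Completes P201 xs y
⇒completes201 (z ∷ xs) {y} y<peak y∉gaps with z <? peak xs
... | yes z<peak with y<peak′ ← subst (y <_) (peak-below xs z<peak) y<peak | y ∈? gaps201 xs
...   | no y∉gaps′ = completes-earlier P201 z (⇒completes201 xs y<peak′ y∉gaps′)
...   | yes y∈gaps with y ≤? z
...     | yes y≤z = ⊥-elim (y∉gaps (∈-filter⁺ (_≤? z) y∈gaps y≤z))
...     | no  y≰z = let a , a∈xs , y<a = <peak⇒∃ xs y<peak′
                    in a , z , newest a∈xs , ≰⇒> y≰z , y<a
⇒completes201 (z ∷ xs) {y} y<peak y∉gaps | no z≮peak with y <? peak xs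
... | yes y<peak′ = completes-earlier P201 z (⇒completes201 xs y<peak′ (y∉gaps ∘ ∈-++⁺ˡ))
... | no  y≮peak′ = ⊥-elim (y∉gaps (∈-++⁺ʳ (gaps201 xs)
                      (∈-interval⁺ (≮⇒≥ y≮peak′) (subst (y <_) (peak-above xs z≮peak) y<peak))))

Allowed201 : List ℕ → ℕ → Set
Allowed201 xs y = y ∈ gaps201 xs ⊎ peak xs ≤ y

admissible201⇒ : ∀ xs {y} → ¬ Completes P201 xs y → Allowed201 xs y
admissible201⇒ xs {y} ¬201 with y ∈? gaps201 xs | y <? peak xs
... | yes y∈gaps | _          = inj₁ y∈gaps
... | no  _      | no y≮peak  = inj₂ (≮⇒≥ y≮peak)
... | no  y∉gaps | yes y<peak = ⊥-elim (¬201 (⇒completes201 xs y<peak y∉gaps))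

⇒admissible201 : ∀ xs {y} → Allowed201 xs y → ¬ Completes P201 xs y
⇒admissible201 xs (inj₁ y∈gaps) c = proj₂ (completes201⇒ xs c) y∈gaps
⇒admissible201 xs (inj₂ peak≤y) c = <⇒≱ (proj₁ (completes201⇒ xs c)) peak≤y

reflect : ℕ → ℕ → ℕ
reflect M x = M ∸ suc x

reflect-involutive : ∀ {M x} → x < M → reflect M (reflect M x) ≡ x
reflect-involutive {suc M} (s≤s x≤M) = m∸[m∸n]≡n x≤M

reflect-< : ∀ {M} x → 0 < M → reflect M x < M
reflect-< {suc M} x _ = s≤s (m∸n≤m M x)

reflect-<ˡ : ∀ {L s M x} → L + s ≡ M → s ≤ x → x < M → reflect M x < L
reflect-<ˡ {L} {s} {M} {x} L+s≡M s≤x x<M = ≰⇒> λ L≤reflect → <-irrefl refl (begin-strict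
  M                   ≡⟨ sym L+s≡M ⟩
  L + s               <⟨ +-mono-≤-< L≤reflect (s≤s s≤x) ⟩
  reflect M x + suc x ≡⟨ m∸n+n≡m x<M ⟩
  M                   ∎)
  where open ≤-Reasoning

reflect-≥ʳ : ∀ {L s M c} → L + s ≡ M → c < L → s ≤ reflect M c
reflect-≥ʳ {L} {s} {M} {c} L+s≡M c<L = begin
  s           ≡⟨ sym (m+n∸m≡n L s) ⟩
  L + s ∸ L   ≤⟨ ∸-monoʳ-≤ (L + s) c<L ⟩
  L + s ∸ suc c ≡⟨ cong (_∸ suc c) L+s≡M ⟩
  reflect M c ∎
  where open ≤-Reasoning

-- Corresponding prefixes l (avoiding 210) and r (avoiding 201): same peak,
-- and as many gaps of r as admissible values of l below the peak.
record Corresponds (l r : List ℕ) : Set where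
  constructor correspond
  field
    same-peak : peak l ≡ peak r
    gap-count : length (gaps201 r) + bound210 l ≡ peak r

gaps≤peak : ∀ {l r} → Corresponds l r → length (gaps201 r) ≤ peak r
gaps≤peak {l} {r} (correspond _ gap-count) = subst (length (gaps201 r) ≤_) gap-count (m≤m+n _ _)

bound≤peak : ∀ {l r} → Corresponds l r → bound210 l ≤ peak r
bound≤peak {l} {r} (correspond _ gap-count) = subst (bound210 l ≤_) gap-count (m≤n+m _ _)

correspond-above : ∀ {l r x} → Corresponds l r → ¬ x < peak r → Corresponds (x ∷ l) (x ∷ r)
correspond-above {l} {r} {x} (correspond same-peak gap-count) x≮peak =
  correspond (trans (peak-above l x≮peakˡ) (sym (peak-above r x≮peak))) (begin
    length (gaps201 (x ∷ r)) + bound210 (x ∷ l)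
      ≡⟨ cong₂ _+_ (cong length (gaps201-above r x≮peak)) (bound210-above l x≮peakˡ) ⟩
    length (gaps201 r ++ interval (peak r) x) + bound210 l
      ≡⟨ cong (_+ bound210 l) (trans (length-++ (gaps201 r))
                                     (cong (length (gaps201 r) +_) (length-applyUpTo _ _))) ⟩
    length (gaps201 r) + (x ∸ peak r) + bound210 l
      ≡⟨ +-assoc (length (gaps201 r)) _ _ ⟩
    length (gaps201 r) + ((x ∸ peak r) + bound210 l)
      ≡⟨ cong (length (gaps201 r) +_) (+-comm (x ∸ peak r) _) ⟩
    length (gaps201 r) + (bound210 l + (x ∸ peak r))
      ≡⟨ sym (+-assoc (length (gaps201 r)) _ _) ⟩
    length (gaps201 r) + bound210 l + (x ∸ peak r)
      ≡⟨ cong (_+ (x ∸ peak r)) gap-count ⟩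
    peak r + (x ∸ peak r)
      ≡⟨ m+[n∸m]≡n (≮⇒≥ x≮peak) ⟩
    x
      ≡⟨ sym (peak-above r x≮peak) ⟩
    peak (x ∷ r) ∎)
  where
  open ≡-Reasoning
  x≮peakˡ : ¬ x < peak l
  x≮peakˡ = x≮peak ∘ subst (x <_) same-peak

bound≤reflect : ∀ {l r j} → Corresponds l r → j < length (gaps201 r) →
                bound210 l ≤ reflect (peak r) j
bound≤reflect c = reflect-≥ʳ (Corresponds.gap-count c)

correspond-below : ∀ {l r j} → Corresponds l r → j < length (gaps201 r) →
                   Corresponds (reflect (peak r) j ∷ l) (nth (gaps201 r) j ∷ r)
correspond-below {l} {r} {j} c@(correspond same-peak gap-count) j<len =
  correspond (trans (peak-below l (subst (x <_) (sym same-peak) x<peak))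
                    (trans same-peak (sym (peak-below r y<peak)))) (begin
    length (gaps201 (y ∷ r)) + bound210 (x ∷ l)
      ≡⟨ cong₂ _+_ (cong length (gaps201-below r y<peak))
                   (bound210-below l (subst (x <_) (sym same-peak) x<peak)) ⟩
    length (filter (_≤? y) (gaps201 r)) + (bound210 l ⊔ x)
      ≡⟨ cong₂ _+_ (trans (length-atMost (gaps201-sorted r) y∈gaps)
                          (cong suc (rank-nth (gaps201-sorted r) j<len)))
                   (m≤n⇒m⊔n≡n (bound≤reflect c j<len)) ⟩
    suc j + x
      ≡⟨ m+[n∸m]≡n j<peak ⟩
    peak r
      ≡⟨ sym (peak-below r y<peak) ⟩
    peak (y ∷ r) ∎)
  where
  open ≡-Reasoning
  x : ℕ
  x = reflect (peak r) j
  y : ℕ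
  y = nth (gaps201 r) j
  y∈gaps : y ∈ gaps201 r
  y∈gaps = nth-∈ (gaps201 r) j<len
  y<peak : y < peak r
  y<peak = All.lookup (gaps201-<peak r) y∈gaps
  j<peak : j < peak r
  j<peak = <-≤-trans j<len (gaps≤peak c)
  x<peak : x < peak r
  x<peak = reflect-< j (≤-<-trans z≤n j<peak)

φ : List ℕ → ℕ → ℕ
φ r x with x <? peak r
... | yes _ = nth (gaps201 r) (reflect (peak r) x)
... | no  _ = x

ψ : List ℕ → ℕ → ℕ
ψ r y with y <? peak r
... | yes _ = reflect (peak r) (rank y (gaps201 r))
... | no  _ = y

φ-below : ∀ r {x} → x < peak r → φ r x ≡ nth (gaps201 r) (reflect (peak r) x)
φ-below r {x} x<peak with x <? peak r
... | yes _     = refl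
... | no x≮peak = ⊥-elim (x≮peak x<peak)

ψ-below : ∀ r {y} → y < peak r → ψ r y ≡ reflect (peak r) (rank y (gaps201 r))
ψ-below r {y} y<peak with y <? peak r
... | yes _     = refl
... | no y≮peak = ⊥-elim (y≮peak y<peak)

φ-above : ∀ r {x} → ¬ x < peak r → φ r x ≡ x
φ-above r {x} x≮peak with x <? peak r
... | yes x<peak = ⊥-elim (x≮peak x<peak)
... | no  _      = refl

ψ-above : ∀ r {y} → ¬ y < peak r → ψ r y ≡ y
ψ-above r {y} y≮peak with y <? peak r
... | yes y<peak = ⊥-elim (y≮peak y<peak)
... | no  _      = refl

φ-≤ : ∀ r {x k} → peak r ≤ k → x ≤ k → φ r x ≤ k
φ-≤ r {x} peak≤k x≤k with x <? peak r
... | yes x<peak =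
  <⇒≤ (<-≤-trans (nth-< (gaps201 r) _ (≤-<-trans z≤n x<peak) (gaps201-<peak r)) peak≤k)
... | no  _      = x≤k

ψ-≤ : ∀ r {y k} → peak r ≤ k → y ≤ k → ψ r y ≤ k
ψ-≤ r {y} peak≤k y≤k with y <? peak r
... | yes y<peak = <⇒≤ (<-≤-trans (reflect-< _ (≤-<-trans z≤n y<peak)) peak≤k)
... | no  _      = y≤k

step-forward : ∀ {l r x} → Corresponds l r → bound210 l ≤ x →
               Allowed201 r (φ r x) × Corresponds (x ∷ l) (φ r x ∷ r) × ψ r (φ r x) ≡ x
step-forward {l} {r} {x} c bound≤x with x <? peak r
... | no x≮peak = inj₂ (≮⇒≥ x≮peak) , correspond-above c x≮peak , ψ-above r x≮peak
... | yes x<peak =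
  inj₁ y∈gaps ,
  subst (λ x′ → Corresponds (x′ ∷ l) (y ∷ r)) (reflect-involutive x<peak)
        (correspond-below c j<len) ,
  (begin
    ψ r y
      ≡⟨ ψ-below r (All.lookup (gaps201-<peak r) y∈gaps) ⟩
    reflect (peak r) (rank y (gaps201 r))
      ≡⟨ cong (reflect (peak r)) (rank-nth (gaps201-sorted r) j<len) ⟩
    reflect (peak r) j
      ≡⟨ reflect-involutive x<peak ⟩
    x ∎)
  where
  open ≡-Reasoning
  j : ℕ
  j = reflect (peak r) x
  j<len : j < length (gaps201 r)
  j<len = reflect-<ˡ (Corresponds.gap-count c) bound≤x x<peak
  y : ℕ
  y = nth (gaps201 r) j
  y∈gaps : y ∈ gaps201 r
  y∈gaps = nth-∈ (gaps201 r) j<len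

step-backward : ∀ {l r y} → Corresponds l r → Allowed201 r y →
                bound210 l ≤ ψ r y × Corresponds (ψ r y ∷ l) (y ∷ r) × φ r (ψ r y) ≡ y
step-backward {l} {r} {y} c allowed with y <? peak r | allowed
... | no y≮peak | _ =
  ≤-trans (bound≤peak c) (≮⇒≥ y≮peak) , correspond-above c y≮peak , φ-above r y≮peak
... | yes y<peak | inj₂ peak≤y = ⊥-elim (<⇒≱ y<peak peak≤y)
... | yes y<peak | inj₁ y∈gaps =
  bound≤reflect c j<len ,
  subst (λ y′ → Corresponds (x ∷ l) (y′ ∷ r)) (nth-rank (gaps201-sorted r) y∈gaps)
        (correspond-below c j<len) ,
  (begin
    φ r x
      ≡⟨ φ-below r (reflect-< j (≤-<-trans z≤n y<peak)) ⟩
    nth (gaps201 r) (reflect (peak r) x)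
      ≡⟨ cong (nth (gaps201 r)) (reflect-involutive (<-≤-trans j<len (gaps≤peak c))) ⟩
    nth (gaps201 r) j
      ≡⟨ nth-rank (gaps201-sorted r) y∈gaps ⟩
    y ∎)
  where
  open ≡-Reasoning
  j : ℕ
  j = rank y (gaps201 r)
  j<len : j < length (gaps201 r)
  j<len = rank<length (gaps201 r) y∈gaps
  x : ℕ
  x = reflect (peak r) j

Φ : List ℕ → List ℕ
Φ []      = []
Φ (x ∷ l) = φ (Φ l) x ∷ Φ l

Ψ : List ℕ → List ℕ
Ψ []      = []
Ψ (y ∷ r) = ψ r y ∷ Ψ r

length-Φ : ∀ l → length (Φ l) ≡ length l
length-Φ []      = refl
length-Φ (x ∷ l) = cong suc (length-Φ l)

length-Ψ : ∀ r → length (Ψ r) ≡ length r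
length-Ψ []      = refl
length-Ψ (y ∷ r) = cong suc (length-Ψ r)

Φ-correct : ∀ l → IsInvSeq l → Avoiding P210 l →
            Corresponds l (Φ l) × IsInvSeq (Φ l) × Avoiding P201 (Φ l)
Φ-correct []      _            _            = correspond refl refl , tt , tt
Φ-correct (x ∷ l) (x≤len , inv) (avoid , ¬210)
  with c , invΦ , avoidΦ ← Φ-correct l inv avoid
  with allowed , c′ , _ ← step-forward c (admissible210⇒ l ¬210) =
  c′ ,
  (φ-≤ (Φ l) (peak≤length (Φ l) invΦ) (subst (x ≤_) (sym (length-Φ l)) x≤len) , invΦ) ,
  (avoidΦ , ⇒admissible201 (Φ l) allowed)

Ψ-correct : ∀ r → IsInvSeq r → Avoiding P201 r →
            Corresponds (Ψ r) r × IsInvSeq (Ψ r) × Avoiding P210 (Ψ r)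
Ψ-correct []      _            _            = correspond refl refl , tt , tt
Ψ-correct (y ∷ r) (y≤len , inv) (avoid , ¬201)
  with c , invΨ , avoidΨ ← Ψ-correct r inv avoid
  with bound≤ , c′ , _ ← step-backward c (admissible201⇒ r ¬201) =
  c′ ,
  (subst (ψ r y ≤_) (sym (length-Ψ r)) (ψ-≤ r (peak≤length r inv) y≤len) , invΨ) ,
  (avoidΨ , ⇒admissible210 (Ψ r) bound≤)

Ψ∘Φ : ∀ l → IsInvSeq l → Avoiding P210 l → Ψ (Φ l) ≡ l
Ψ∘Φ []      _            _            = refl
Ψ∘Φ (x ∷ l) (_ , inv) (avoid , ¬210)
  with c , _ ← Φ-correct l inv avoid
  with _ , _ , ψφx≡x ← step-forward c (admissible210⇒ l ¬210) =
  cong₂ _∷_ ψφx≡x (Ψ∘Φ l inv avoid)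

Φ∘Ψ : ∀ r → IsInvSeq r → Avoiding P201 r → Φ (Ψ r) ≡ r
Φ∘Ψ []      _            _            = refl
Φ∘Ψ (y ∷ r) (_ , inv) (avoid , ¬201)
  with c , _ ← Ψ-correct r inv avoid
  with _ , _ , φψy≡y ← step-backward c (admissible201⇒ r ¬201) =
  cong₂ _∷_ (trans (cong (λ r′ → φ r′ (ψ r y)) (Φ∘Ψ r inv avoid)) φψy≡y) (Φ∘Ψ r inv avoid)

-- The list applyDownFrom g n = g (n-1) ∷ … ∷ g 0 represents the sequence
-- g 0, …, g (n-1); the list notions above become statements about g.

before-applyDownFrom⁻ : ∀ g {n a b} → Before (applyDownFrom g n) a b →
                        ∃[ i ] ∃[ j ] i < j × j < n × g i ≡ a × g j ≡ b
before-applyDownFrom⁻ g {suc n} (earlier a⋯b) =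
  let i , j , i<j , j<n , gi≡a , gj≡b = before-applyDownFrom⁻ g a⋯b
  in i , j , i<j , m<n⇒m<1+n j<n , gi≡a , gj≡b
before-applyDownFrom⁻ g {suc n} (newest a∈) =
  let i , i<n , a≡gi = Any.applyDownFrom⁻ g a∈ in i , n , i<n , ≤-refl , sym a≡gi , refl

before-applyDownFrom⁺ : ∀ g {i j n} → i < j → j < n → Before (applyDownFrom g n) (g i) (g j)
before-applyDownFrom⁺ g {i} {j} {suc n} i<j j<1+n with j ≟ n
... | yes refl = newest (Any.applyDownFrom⁺ g refl i<j)
... | no  j≢n  = earlier (before-applyDownFrom⁺ g i<j (≤∧≢⇒< (≤-pred j<1+n) j≢n))

AvoidsFn : Pattern → (ℕ → ℕ) → ℕ → Set
AvoidsFn P g n = ∀ {i j k} → i < j → j < k → k < n → ¬ P (g i) (g j) (g k)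

avoiding-applyDownFrom⁺ : ∀ P g n → AvoidsFn P g n → Avoiding P (applyDownFrom g n)
avoiding-applyDownFrom⁺ P g zero    _      = tt
avoiding-applyDownFrom⁺ P g (suc n) avoids =
  avoiding-applyDownFrom⁺ P g n (λ i<j j<k k<n → avoids i<j j<k (m<n⇒m<1+n k<n)) ,
  λ (a , b , a⋯b , pat) → let i , j , i<j , j<n , gi≡a , gj≡b = before-applyDownFrom⁻ g a⋯b
                          in avoids i<j j<n ≤-refl
                                    (subst₂ (λ a b → P a b (g n)) (sym gi≡a) (sym gj≡b) pat)

avoiding-applyDownFrom⁻ : ∀ P g n → Avoiding P (applyDownFrom g n) → AvoidsFn P g n
avoiding-applyDownFrom⁻ P g (suc n) (avoid , ¬completes) {i} {j} i<j j<k k<1+n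
  with m≤n⇒m<n∨m≡n (≤-pred k<1+n)
... | inj₁ k<n  = avoiding-applyDownFrom⁻ P g n avoid i<j j<k k<n
... | inj₂ refl = λ pat → ¬completes (g i , g j , before-applyDownFrom⁺ g i<j j<k , pat)

isInvSeq-applyDownFrom⁺ : ∀ g n → (∀ {i} → i < n → g i ≤ i) → IsInvSeq (applyDownFrom g n)
isInvSeq-applyDownFrom⁺ g zero    _       = tt
isInvSeq-applyDownFrom⁺ g (suc n) bounded =
  subst (g n ≤_) (sym (length-applyDownFrom g n)) (bounded ≤-refl) ,
  isInvSeq-applyDownFrom⁺ g n (bounded ∘ m<n⇒m<1+n)

isInvSeq-applyDownFrom⁻ : ∀ g n → IsInvSeq (applyDownFrom g n) → ∀ {i} → i < n → g i ≤ i
isInvSeq-applyDownFrom⁻ g (suc n) (gn≤ , inv) {i} i<1+n with m≤n⇒m<n∨m≡n (≤-pred i<1+n)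
... | inj₁ i<n  = isInvSeq-applyDownFrom⁻ g n inv i<n
... | inj₂ refl = subst (g i ≤_) (length-applyDownFrom g i) gn≤

applyDownFrom-cong : ∀ {g h : ℕ → ℕ} n → (∀ {i} → i < n → g i ≡ h i) →
                     applyDownFrom g n ≡ applyDownFrom h n
applyDownFrom-cong zero    _   = refl
applyDownFrom-cong (suc n) g≗h =
  cong₂ _∷_ (g≗h ≤-refl) (applyDownFrom-cong n (g≗h ∘ m<n⇒m<1+n))

entryAt : List ℕ → ℕ → ℕ
entryAt l i = nth l (reflect (length l) i)

nth-reflect-last : ∀ x l n → nth (x ∷ l) (reflect (suc n) n) ≡ x
nth-reflect-last x l n = cong (nth (x ∷ l)) (n∸n≡0 n)

nth-reflect-earlier : ∀ x l {n i} → i < n → nth (x ∷ l) (reflect (suc n) i) ≡ nth l (reflect n i)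
nth-reflect-earlier x l i<n = cong (nth (x ∷ l)) (+-∸-assoc 1 i<n)

nth-applyDownFrom : ∀ g n {i} → i < n → nth (applyDownFrom g n) (reflect n i) ≡ g i
nth-applyDownFrom g (suc n) {i} i<1+n with m≤n⇒m<n∨m≡n (≤-pred i<1+n)
... | inj₁ i<n  = trans (nth-reflect-earlier (g n) _ i<n) (nth-applyDownFrom g n i<n)
... | inj₂ refl = nth-reflect-last (g i) _ i

applyDownFrom-entryAt : ∀ l → applyDownFrom (entryAt l) (length l) ≡ l
applyDownFrom-entryAt []      = refl
applyDownFrom-entryAt (x ∷ l) =
  cong₂ _∷_ (nth-reflect-last x l (length l))
            (trans (applyDownFrom-cong (length l) (nth-reflect-earlier x l)) (applyDownFrom-entryAt l))

-- An inversion sequence as a function on ℕ (0 beyond its length).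
entry : ∀ {n} → InvSeq n → ℕ → ℕ
entry {n} e i with i <? n
... | yes i<n = val e (fromℕ< i<n)
... | no  _   = 0

entry-fromℕ< : ∀ {n} (e : InvSeq n) {i} (i<n : i < n) → entry e i ≡ val e (fromℕ< i<n)
entry-fromℕ< {n} e {i} i<n with i <? n
... | yes _   = refl
... | no  i≮n = ⊥-elim (i≮n i<n)

entry-toℕ : ∀ {n} (e : InvSeq n) i → entry e (toℕ i) ≡ val e i
entry-toℕ e i = trans (entry-fromℕ< e (toℕ<n i)) (cong (val e) (fromℕ<-toℕ i (toℕ<n i)))

AvoidsSeq : Pattern → ∀ {n} → InvSeq n → Set
AvoidsSeq P {n} e = (i j k : Fin n) → i <ᶠ j → j <ᶠ k → ¬ P (val e i) (val e j) (val e k)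

module Agreeing (P : Pattern) {n} (e : InvSeq n) (g : ℕ → ℕ)
                (agree : ∀ i → val e i ≡ g (toℕ i)) where

  agree-fromℕ< : ∀ {i} (i<n : i < n) → val e (fromℕ< i<n) ≡ g i
  agree-fromℕ< i<n = trans (agree _) (cong g (toℕ-fromℕ< i<n))

  bounded : ∀ {i} → i < n → g i ≤ i
  bounded i<n =
    subst₂ _≤_ (agree-fromℕ< i<n) (toℕ-fromℕ< i<n) (≤-pred (toℕ<n (e (fromℕ< i<n))))

  P-cong : ∀ {a a′ b b′ c c′} → a ≡ a′ → b ≡ b′ → c ≡ c′ → P a b c → P a′ b′ c′
  P-cong refl refl refl pat = pat

  avoidsFn⇒avoidsSeq : AvoidsFn P g n → AvoidsSeq P e
  avoidsFn⇒avoidsSeq avoids i j k i<j j<k =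
    avoids i<j j<k (toℕ<n k) ∘ P-cong (agree i) (agree j) (agree k)

  avoidsSeq⇒avoidsFn : AvoidsSeq P e → AvoidsFn P g n
  avoidsSeq⇒avoidsFn avoids {i} {j} {k} i<j j<k k<n =
    avoids (fromℕ< i<n) (fromℕ< j<n) (fromℕ< k<n)
           (subst₂ _<_ (sym (toℕ-fromℕ< i<n)) (sym (toℕ-fromℕ< j<n)) i<j)
           (subst₂ _<_ (sym (toℕ-fromℕ< j<n)) (sym (toℕ-fromℕ< k<n)) j<k)
    ∘ P-cong (sym (agree-fromℕ< i<n)) (sym (agree-fromℕ< j<n)) (sym (agree-fromℕ< k<n))
    where
    j<n : j < n
    j<n = <-trans j<k k<n
    i<n : i < n
    i<n = <-trans i<j j<n

record Code (P : Pattern) (n : ℕ) : Set where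
  constructor code
  field
    list     : List ℕ
    length≡  : length list ≡ n
    isInvSeq : IsInvSeq list
    avoiding : Avoiding P list

module _ {P : Pattern} {n : ℕ} where

  encode : Σ (InvSeq n) (AvoidsSeq P) → Code P n
  encode (e , avoids) =
    code (applyDownFrom (entry e) n) (length-applyDownFrom (entry e) n)
         (isInvSeq-applyDownFrom⁺ (entry e) n bounded)
         (avoiding-applyDownFrom⁺ P (entry e) n (avoidsSeq⇒avoidsFn avoids))
    where open Agreeing P e (entry e) (sym ∘ entry-toℕ e)

  decode : Code P n → Σ (InvSeq n) (AvoidsSeq P)
  decode (code l refl inv avoid) =
    e , avoidsFn⇒avoidsSeq (avoiding-applyDownFrom⁻ P (entryAt l) (length l) avoid′)
    where
    inv′ : IsInvSeq (applyDownFrom (entryAt l) (length l))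
    inv′   = subst IsInvSeq (sym (applyDownFrom-entryAt l)) inv
    avoid′ : Avoiding P (applyDownFrom (entryAt l) (length l))
    avoid′ = subst (Avoiding P) (sym (applyDownFrom-entryAt l)) avoid
    e : InvSeq (length l)
    e i = fromℕ< (s≤s (isInvSeq-applyDownFrom⁻ (entryAt l) (length l) inv′ (toℕ<n i)))
    open Agreeing P e (entryAt l) (λ i → toℕ-fromℕ< _)

  decode-val : ∀ c i → val (proj₁ (decode c)) i ≡ entryAt (Code.list c) (toℕ i)
  decode-val (code l refl inv avoid) i = toℕ-fromℕ< _

  encode-decode : ∀ c → Code.list (encode (decode c)) ≡ Code.list c
  encode-decode c@(code l refl inv avoid) =
    trans (applyDownFrom-cong n λ i<n →
             trans (entry-fromℕ< e i<n)
                   (trans (decode-val c (fromℕ< i<n)) (cong (entryAt l) (toℕ-fromℕ< i<n))))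
          (applyDownFrom-entryAt l)
    where
    e : InvSeq n
    e = proj₁ (decode c)

  entryAt-encode : ∀ x i → entryAt (Code.list (encode x)) (toℕ i) ≡ val (proj₁ x) i
  entryAt-encode (e , _) i = begin
    nth (applyDownFrom (entry e) n) (reflect (length (applyDownFrom (entry e) n)) (toℕ i))
      ≡⟨ cong (λ m → nth (applyDownFrom (entry e) n) (reflect m (toℕ i)))
              (length-applyDownFrom (entry e) n) ⟩
    nth (applyDownFrom (entry e) n) (reflect n (toℕ i))
      ≡⟨ nth-applyDownFrom (entry e) n (toℕ<n i) ⟩
    entry e (toℕ i)
      ≡⟨ entry-toℕ e i ⟩
    val e i ∎
    where open ≡-Reasoning

  decode-encode : ∀ c x → Code.list c ≡ Code.list (encode x) → proj₁ (decode c) ≈ˢ proj₁ x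
  decode-encode c x same-list i = toℕ-injective (begin
    val (proj₁ (decode c)) i          ≡⟨ decode-val c i ⟩
    entryAt (Code.list c) (toℕ i)     ≡⟨ cong (λ l → entryAt l (toℕ i)) same-list ⟩
    entryAt (Code.list (encode x)) (toℕ i) ≡⟨ entryAt-encode x i ⟩
    val (proj₁ x) i                   ∎)
    where open ≡-Reasoning

induced : ∀ {P Q n} → (Code P n → Code Q n) →
          Σ (InvSeq n) (AvoidsSeq P) → Σ (InvSeq n) (AvoidsSeq Q)
induced F = decode ∘ F ∘ encode

induced-inverse : ∀ {P Q n} (F : Code P n → Code Q n) (G : Code Q n → Code P n) →
                  (∀ c → Code.list (G (encode (decode (F c)))) ≡ Code.list c) →
                  ∀ x → proj₁ (induced G (induced F x)) ≈ˢ proj₁ x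
induced-inverse F G G∘F x = decode-encode (G (encode (decode (F (encode x))))) x (G∘F (encode x))

Φᶜ : ∀ {n} → Code P210 n → Code P201 n
Φᶜ (code l len inv avoid) =
  let _ , invΦ , avoidΦ = Φ-correct l inv avoid in code (Φ l) (trans (length-Φ l) len) invΦ avoidΦ

Ψᶜ : ∀ {n} → Code P201 n → Code P210 n
Ψᶜ (code r len inv avoid) =
  let _ , invΨ , avoidΨ = Ψ-correct r inv avoid in code (Ψ r) (trans (length-Ψ r) len) invΨ avoidΨ

Ψᶜ∘Φᶜ : ∀ {n} (c : Code P210 n) → Code.list (Ψᶜ (encode (decode (Φᶜ c)))) ≡ Code.list c
Ψᶜ∘Φᶜ c = trans (cong Ψ (encode-decode (Φᶜ c)))
                 (Ψ∘Φ (Code.list c) (Code.isInvSeq c) (Code.avoiding c))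

Φᶜ∘Ψᶜ : ∀ {n} (c : Code P201 n) → Code.list (Φᶜ (encode (decode (Ψᶜ c)))) ≡ Code.list c
Φᶜ∘Ψᶜ c = trans (cong Φ (encode-decode (Ψᶜ c)))
                 (Φ∘Ψ (Code.list c) (Code.isInvSeq c) (Code.avoiding c))

theorem5 : (n : ℕ) → n ≥ 1 → SameSize n
theorem5 n _ = record
  { to      = induced Φᶜ
  ; from    = induced Ψᶜ
  ; from∘to = induced-inverse Φᶜ Ψᶜ Ψᶜ∘Φᶜ
  ; to∘from = induced-inverse Ψᶜ Φᶜ Φᶜ∘Ψᶜ
  }
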